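{- Let $m$ be a positive integer. (i) Assume that $p = 2m+1$ is a prime congruent to $3$ modulo $4$. Then $T_m$ cannot be written in the form $x^2+y^2+T_z$ with $x,y,z\in\mathbb{Z}$, $x^2+y^2>0$ and $x\equiv y \pmod 2$. Also, $2T_m$ cannot be written as $x^2 + T_y + T_z$ with $x,y,z\in\mathbb{Z}$, $x$ even and $x\neq 0$. (ii) Assume that all prime divisors of $2m+1$ are congruent to $1$ modulo $4$. Then $T_m$ cannot be written as $x^2+y^2+T_z$ with $x,y,z\in\mathbb{Z}$, $x$ odd and $y$ even. Also, $2T_m$ cannot be written as $x^2+T_y+T_z$ with $x,y,z\in\mathbb{Z}$ and $x$ odd.
   Context: For $x\in\mathbb{Z}$, the triangular number $T_x$ is $T_x = x(x+1)/2$. -}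

module Defs where

open import Data.Integer using (ℤ; _+_; _*_; +_)
open import Data.Integer.DivMod using (_/_)

-- Triangular number T_x = x(x+1)/2 for x ∈ ℤ (x(x+1) is always even, so the division is exact).
T : ℤ → ℤ
T x = (x * (x + + 1)) / + 2

{-# OPTIONS --safe #-}
-- Since 8 T_z + 1 = (2z + 1)², with p = 2m + 1 the two representations become
-- p² = 8(x² + y²) + w² and 2p² = 8x² + a² + b² with w, a, b odd. In the first, p² − w² = 8(x² + y²)
-- splits as 8oc with o odd and o + 2c = p; in the second, a² + b² = 2(f² + e²) with f odd and e even,
-- and p² − e² = (2x)² + f² splits as u(p + e) with u + e = p. The parity hypotheses force o, resp. u,
-- to be ≡ 3 (mod 4). A number ≡ 3 (mod 4) whose product with c is a sum of two squares shares with c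
-- a prime q ≡ 3 (mod 4): such a prime divides a sum of two squares only through both squares, because
-- no n ≡ 3 (mod 4) divides y² + 1 (by descent). Then q divides p. In part (ii) this contradicts the
-- hypothesis on the prime factors of p; in part (i) it gives q = p, impossible since 0 < o < p, resp.
-- since it forces u = p, e = 0 and p² = (2x)² + f² with 2x, f > 0.

module Submission where

module Congruence where

  open import Data.Nat
  open import Data.Nat.DivMod hiding (_mod_)
  open import Data.Nat.Divisibility using (_∣_; divides; n∣m⇒m%n≡0; m%n≡0⇒n∣m)
  open import Data.Nat.Properties using (allUpTo?; _≟_; *-comm; *-identityʳ; <-trans)
  open import Level using (0ℓ)
  open import Relation.Binary.Bundles using (Setoid)
  open import Data.Sum as Sum using (_⊎_; inj₁; inj₂)
  open import Data.Product as Product using (_×_; _,_)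
  open import Relation.Binary.PropositionalEquality
  open import Relation.Nullary.Decidable using (Dec; map′; True; toWitness; _→-dec_; _⊎-dec_; _×-dec_)
  open import Relation.Unary using (Decidable)
  open import Relation.Nullary.Negation using (¬_; contradiction)

  infix 4 _≡_mod_ _≟_mod_

  -- A record rather than the bare equation a % n ≡ b % n, so that a and b can be inferred from the type.
  record _≡_mod_ (a b n : ℕ) .{{_ : NonZero n}} : Set where
    constructor %≡⇒mod
    field mod⇒%≡ : a % n ≡ b % n

  open _≡_mod_ public

  Even Odd : ℕ → Set
  Even a = a ≡ 0 mod 2
  Odd a = a ≡ 1 mod 2

  module _ {n : ℕ} .{{_ : NonZero n}} where

    mod-refl : ∀ {a} → a ≡ a mod n
    mod-refl = %≡⇒mod refl

    mod-sym : ∀ {a b} → a ≡ b mod n → b ≡ a mod n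
    mod-sym (%≡⇒mod p) = %≡⇒mod (sym p)

    mod-trans : ∀ {a b c} → a ≡ b mod n → b ≡ c mod n → a ≡ c mod n
    mod-trans (%≡⇒mod p) (%≡⇒mod q) = %≡⇒mod (trans p q)

    ≡⇒mod : ∀ {a b} → a ≡ b → a ≡ b mod n
    ≡⇒mod refl = mod-refl

    mod-+ : ∀ {a b c d} → a ≡ b mod n → c ≡ d mod n → a + c ≡ b + d mod n
    mod-+ {a} {b} {c} {d} (%≡⇒mod p) (%≡⇒mod q) = %≡⇒mod (begin
      (a + c) % n             ≡⟨ %-distribˡ-+ a c n ⟩
      (a % n + c % n) % n     ≡⟨ cong₂ (λ x y → (x + y) % n) p q ⟩
      (b % n + d % n) % n     ≡⟨ %-distribˡ-+ b d n ⟨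
      (b + d) % n             ∎)
      where open ≡-Reasoning

    mod-* : ∀ {a b c d} → a ≡ b mod n → c ≡ d mod n → a * c ≡ b * d mod n
    mod-* {a} {b} {c} {d} (%≡⇒mod p) (%≡⇒mod q) = %≡⇒mod (begin
      (a * c) % n             ≡⟨ %-distribˡ-* a c n ⟩
      (a % n * (c % n)) % n   ≡⟨ cong₂ (λ x y → (x * y) % n) p q ⟩
      (b % n * (d % n)) % n   ≡⟨ %-distribˡ-* b d n ⟨
      (b * d) % n             ∎)
      where open ≡-Reasoning

    mod-*ˡ : ∀ k {a b} → a ≡ b mod n → k * a ≡ k * b mod n
    mod-*ˡ k = mod-* (mod-refl {k})

    mod-% : ∀ a → a % n ≡ a mod n
    mod-% a = %≡⇒mod (m%n%n≡m%n a n)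

    mod-*n : ∀ k → k * n ≡ 0 mod n
    mod-*n k = %≡⇒mod (trans (m*n%n≡0 k n) (sym (m*n%n≡0 0 n)))

  mod-setoid : (n : ℕ) .{{_ : NonZero n}} → Setoid 0ℓ 0ℓ
  mod-setoid n = record
    { Carrier = ℕ
    ; _≈_ = λ a b → a ≡ b mod n
    ; isEquivalence = record { refl = mod-refl ; sym = mod-sym ; trans = mod-trans }
    }

  mod-∣ : ∀ {m n a b} .{{_ : NonZero m}} .{{_ : NonZero n}} → m ∣ n → a ≡ b mod n → a ≡ b mod m
  mod-∣ {m} {n} {a} {b} m∣n (%≡⇒mod p) = %≡⇒mod (begin
    a % m         ≡⟨ m∣n⇒o%n%m≡o%m m n a m∣n ⟨
    a % n % m     ≡⟨ cong (_% m) p ⟩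
    b % n % m     ≡⟨ m∣n⇒o%n%m≡o%m m n b m∣n ⟩
    b % m         ∎)
    where open ≡-Reasoning

  %-mod-∣ : ∀ {m n} .{{_ : NonZero m}} .{{_ : NonZero n}} → m ∣ n → ∀ a → a % n ≡ a mod m
  %-mod-∣ m∣n a = mod-∣ m∣n (mod-% a)

  mod-resp-∣ : ∀ {n a b} .{{_ : NonZero n}} → a ≡ b mod n → n ∣ a → n ∣ b
  mod-resp-∣ {n} {a} {b} (%≡⇒mod p) n∣a = m%n≡0⇒n∣m b n (trans (sym p) (n∣m⇒m%n≡0 a n n∣a))

  mod2⇒double-mod4 : ∀ {a b} → a ≡ b mod 2 → 2 * a ≡ 2 * b mod 4
  mod2⇒double-mod4 {a} {b} (%≡⇒mod p) = %≡⇒mod (begin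
    2 * a % 4     ≡⟨ cong (_% 4) (*-comm 2 a) ⟩
    a * 2 % 4     ≡⟨ m%n*o≡m*o%[n*o] a 2 2 ⟨
    a % 2 * 2     ≡⟨ cong (_* 2) p ⟩
    b % 2 * 2     ≡⟨ m%n*o≡m*o%[n*o] b 2 2 ⟩
    b * 2 % 4     ≡⟨ cong (_% 4) (*-comm b 2) ⟩
    2 * b % 4     ∎)
    where open ≡-Reasoning

  _≟_mod_ : ∀ a b n .{{_ : NonZero n}} → Dec (a ≡ b mod n)
  a ≟ b mod n = map′ %≡⇒mod mod⇒%≡ (a % n ≟ b % n)

  -- check decides P on every residue below n; for concrete n and P it evaluates to tt, so callers pass _.
  module _ (n : ℕ) .{{_ : NonZero n}} where

    by-residues : (P : ℕ → Set) (P? : Decidable P) → True (allUpTo? P? n) → ∀ a → P (a % n)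
    by-residues P P? check a = toWitness check (m%n<n a n)

    by-residues₂ : (P : ℕ → ℕ → Set) (P? : ∀ r → Decidable (P r)) →
                   True (allUpTo? (λ r → allUpTo? (P? r) n) n) → ∀ a b → P (a % n) (b % n)
    by-residues₂ P P? check a b = toWitness check (m%n<n a n) (m%n<n b n)

  2∣4 : 2 ∣ 4
  2∣4 = divides 2 refl

  2∣8 : 2 ∣ 8
  2∣8 = divides 4 refl

  4∣8 : 4 ∣ 8
  4∣8 = divides 2 refl

  odd⇒square≡1 : ∀ {a} → Odd a → a * a ≡ 1 mod 8
  odd⇒square≡1 {a} a-odd = mod-trans (mod-* (mod-sym (mod-% a)) (mod-sym (mod-% a)))
    (by-residues 8 (λ r → Odd r → r * r ≡ 1 mod 8) (λ r → (r ≟ 1 mod 2) →-dec (r * r ≟ 1 mod 8)) _ a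
      (mod-trans (%-mod-∣ 2∣8 a) a-odd))

  *≡3⇒≡3⊎≡3 : ∀ {a b} → a * b ≡ 3 mod 4 → a ≡ 3 mod 4 ⊎ b ≡ 3 mod 4
  *≡3⇒≡3⊎≡3 {a} {b} ab≡3 = Sum.map (mod-trans (mod-sym (mod-% a))) (mod-trans (mod-sym (mod-% b)))
    (by-residues₂ 4 (λ r s → r * s ≡ 3 mod 4 → r ≡ 3 mod 4 ⊎ s ≡ 3 mod 4)
      (λ r s → (r * s ≟ 3 mod 4) →-dec (r ≟ 3 mod 4 ⊎-dec s ≟ 3 mod 4)) _ a b
      (mod-trans (mod-* (mod-% a) (mod-% b)) ab≡3))

  odd-+ : ∀ {a b} → Odd (a + b) → Odd a × Even b ⊎ Even a × Odd b
  odd-+ {a} {b} a+b-odd = Sum.map (Product.map (mod-trans (mod-sym (mod-% a))) (mod-trans (mod-sym (mod-% b))))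
                                  (Product.map (mod-trans (mod-sym (mod-% a))) (mod-trans (mod-sym (mod-% b))))
    (by-residues₂ 2 (λ r s → Odd (r + s) → Odd r × Even s ⊎ Even r × Odd s)
      (λ r s → (r + s ≟ 1 mod 2) →-dec ((r ≟ 1 mod 2 ×-dec s ≟ 0 mod 2) ⊎-dec (r ≟ 0 mod 2 ×-dec s ≟ 1 mod 2))) _ a b
      (mod-trans (mod-+ (mod-% a) (mod-% b)) a+b-odd))

  odd⇒≡1⊎≡3 : ∀ {a} → Odd a → a ≡ 1 mod 4 ⊎ a ≡ 3 mod 4
  odd⇒≡1⊎≡3 {a} a-odd = Sum.map (mod-trans (mod-sym (mod-% a))) (mod-trans (mod-sym (mod-% a)))
    (by-residues 4 (λ r → Odd r → r ≡ 1 mod 4 ⊎ r ≡ 3 mod 4)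
      (λ r → (r ≟ 1 mod 2) →-dec (r ≟ 1 mod 4 ⊎-dec r ≟ 3 mod 4)) _ a
      (mod-trans (%-mod-∣ 2∣4 a) a-odd))

  even⇒square≡0 : ∀ {a} → Even a → a * a ≡ 0 mod 4
  even⇒square≡0 {a} a-even = mod-trans (mod-* (mod-sym (mod-% a)) (mod-sym (mod-% a)))
    (by-residues 4 (λ r → Even r → r * r ≡ 0 mod 4) (λ r → (r ≟ 0 mod 2) →-dec (r * r ≟ 0 mod 4)) _ a
      (mod-trans (%-mod-∣ 2∣4 a) a-even))

  odd∧[o+2c+2oc≡3]⇒≡3 : ∀ {o c} → Odd o → o + 2 * c + 2 * (o * c) ≡ 3 mod 4 → o ≡ 3 mod 4
  odd∧[o+2c+2oc≡3]⇒≡3 {o} {c} o-odd h = mod-trans (mod-sym (mod-% o))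
    (by-residues₂ 4 (λ r s → Odd r → r + 2 * s + 2 * (r * s) ≡ 3 mod 4 → r ≡ 3 mod 4)
      (λ r s → (r ≟ 1 mod 2) →-dec (r + 2 * s + 2 * (r * s) ≟ 3 mod 4) →-dec (r ≟ 3 mod 4)) _ o c
      (mod-trans (%-mod-∣ 2∣4 o) o-odd)
      (mod-trans (mod-+ (mod-+ (mod-% o) (mod-*ˡ 2 (mod-% c))) (mod-*ˡ 2 (mod-* (mod-% o) (mod-% c)))) h))

  [4x²+1+e²≡1]⇒e≡2x : ∀ {x e} → 4 * (x * x) + 1 + e * e ≡ 1 mod 8 → e ≡ 2 * x mod 4
  [4x²+1+e²≡1]⇒e≡2x {x} {e} h = mod-trans (mod-sym (%-mod-∣ 4∣8 e))
    (mod-trans (by-residues₂ 8 (λ r s → 4 * (r * r) + 1 + s * s ≡ 1 mod 8 → s ≡ 2 * r mod 4)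
       (λ r s → (4 * (r * r) + 1 + s * s ≟ 1 mod 8) →-dec (s ≟ 2 * r mod 4)) _ x e
       (mod-trans (mod-+ (mod-+ (mod-*ˡ 4 (mod-* (mod-% x) (mod-% x))) mod-refl) (mod-* (mod-% e) (mod-% e))) h))
      (mod-*ˡ 2 (%-mod-∣ 4∣8 x)))

  even⊎odd : ∀ a → Even a ⊎ Odd a
  even⊎odd a = Sum.map (mod-trans (mod-sym (mod-% a))) (mod-trans (mod-sym (mod-% a)))
    (by-residues 2 (λ r → Even r ⊎ Odd r) (λ r → r ≟ 0 mod 2 ⊎-dec r ≟ 1 mod 2) _ a)

  even⇒¬odd : ∀ {a} → Even a → ¬ Odd a
  even⇒¬odd a-even a-odd with mod-trans (mod-sym a-even) a-odd
  ... | %≡⇒mod ()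

  odd[2n+1] : ∀ n → Odd (2 * n + 1)
  odd[2n+1] n = mod-+ (mod-trans (≡⇒mod (*-comm 2 n)) (mod-*n n)) mod-refl

  even[n*[n+1]] : ∀ n → Even (n * (n + 1))
  even[n*[n+1]] n = mod-trans (mod-sym (mod-* (mod-% n) (mod-+ (mod-% n) (mod-refl {a = 1}))))
    (by-residues 2 (λ r → Even (r * (r + 1))) (λ r → r * (r + 1) ≟ 0 mod 2) _ n)

  odd⇒nonZero : ∀ {a} → Odd a → NonZero a
  odd⇒nonZero {suc _} _ = _

  ≡3mod4⇒>1 : ∀ {a} → a ≡ 3 mod 4 → 1 < a
  ≡3mod4⇒>1 {suc (suc _)} _ = s≤s (s≤s z≤n)
  ≡3mod4⇒>1 {0} (%≡⇒mod ())
  ≡3mod4⇒>1 {1} (%≡⇒mod ())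

  ≡3mod4⇒nonZero : ∀ {a} → a ≡ 3 mod 4 → NonZero a
  ≡3mod4⇒nonZero a≡3 = >-nonZero (<-trans (s≤s z≤n) (≡3mod4⇒>1 a≡3))

  ≡3mod4⇒odd : ∀ {a} → a ≡ 3 mod 4 → Odd a
  ≡3mod4⇒odd a≡3 = %≡⇒mod (mod⇒%≡ (mod-∣ 2∣4 a≡3))

  *≡1∧≡3⇒≡3 : ∀ {k n} → k * n ≡ 1 mod 4 → n ≡ 3 mod 4 → k ≡ 3 mod 4
  *≡1∧≡3⇒≡3 {k} {n} kn≡1 n≡3 = mod-trans (mod-sym (mod-% k))
    (by-residues₂ 4 (λ r s → r * s ≡ 1 mod 4 → s ≡ 3 mod 4 → r ≡ 3 mod 4)
      (λ r s → (r * s ≟ 1 mod 4) →-dec (s ≟ 3 mod 4) →-dec (r ≟ 3 mod 4)) _ k n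
      (mod-trans (mod-* (mod-% k) (mod-% n)) kn≡1) (mod-trans (mod-% n) n≡3))

  *odd-square≡3⇒≡3 : ∀ {o p} → Odd p → o * (p * p) ≡ 3 mod 4 → o ≡ 3 mod 4
  *odd-square≡3⇒≡3 {o} {p} p-odd op²≡3 = begin
    o                 ≡⟨ *-identityʳ o ⟨
    o * 1             ≈⟨ mod-*ˡ o (mod-∣ 4∣8 (odd⇒square≡1 p-odd)) ⟨
    o * (p * p)       ≈⟨ op²≡3 ⟩
    3                 ∎
    where open import Relation.Binary.Reasoning.Setoid (mod-setoid 4)

  odd∧odd[+]⇒even : ∀ {a d} → Odd a → Odd (a + d) → Even d
  odd∧odd[+]⇒even a-odd a+d-odd with odd-+ a+d-odd
  ... | inj₁ (_ , d-even) = d-even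
  ... | inj₂ (a-even , _) = contradiction a-odd (even⇒¬odd a-even)

  even⇒2∣ : ∀ {a} → Even a → 2 ∣ a
  even⇒2∣ {a} a-even = m%n≡0⇒n∣m a 2 (mod⇒%≡ a-even)

  2∣⇒even : ∀ {a} → 2 ∣ a → Even a
  2∣⇒even {a} 2∣a = %≡⇒mod (n∣m⇒m%n≡0 a 2 2∣a)

  ¬2∣⇒odd : ∀ {a} → ¬ 2 ∣ a → Odd a
  ¬2∣⇒odd {a} 2∤a with even⊎odd a
  ... | inj₁ a-even = contradiction (even⇒2∣ a-even) 2∤a
  ... | inj₂ a-odd = a-odd

module SumsOfTwoSquares where

  open Congruence
  open import Data.Nat
  open import Data.Nat.Properties
  open import Data.Nat.Divisibility
  open import Data.Nat.DivMod using (m%n<n)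
  open import Data.Nat.Induction using (<-rec)
  open import Data.Nat.Tactic.RingSolver using (solve-∀)
  open import Data.Product using (_×_; _,_; ∃-syntax)
  open import Data.Sum using (inj₁; inj₂)
  open import Relation.Binary.PropositionalEquality
  open import Relation.Nullary.Negation using (¬_; contradiction)
  open import Relation.Nullary.Decidable using (yes; no)
  open import Data.Empty using (⊥-elim)
  open import Data.Nat.Primality using (Prime; prime⇒irreducible; prime⇒nonZero; euclidsLemma)
  open import Data.Nat.Primality.Factorisation using (PrimeFactorisation; factorise)
  open import Data.Nat.ListAction using (product)
  open import Data.List.Base using (_∷_)
  open import Data.List.Relation.Unary.All using (All; []; _∷_)
  open import Data.Nat.Coprimality using (Coprime; coprime-Bézout)
  open import Data.Nat.GCD using (module Bézout)

  reflect-root : ∀ r e c → r + e ∣ r * r + c → r + e ∣ e * e + c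
  reflect-root r e c h = ∣m+n∣m⇒∣n (subst (r + e ∣_) (reflection r e c) (∣m∣n⇒∣m+n (n∣m*n (r + e)) h)) (n∣m*n (2 * r))
    where
    reflection : ∀ r e c → (r + e) * (r + e) + (r * r + c) ≡ 2 * r * (r + e) + (e * e + c)
    reflection = solve-∀

  even-root : ∀ {n} .{{_ : NonZero n}} → Odd n → ∀ y c → n ∣ y * y + c →
              ∃[ e ] (e < n × Even e × n ∣ e * e + c)
  even-root {n} n-odd y c n∣y²+c = even-root-below (m%n<n y n) n∣r²+c
    where
    n∣r²+c : n ∣ (y % n) * (y % n) + c
    n∣r²+c = mod-resp-∣ (mod-+ (mod-* (mod-sym (mod-% y)) (mod-sym (mod-% y))) mod-refl) n∣y²+c

    even-root-below : ∀ {r} → r < n → n ∣ r * r + c → ∃[ e ] (e < n × Even e × n ∣ e * e + c)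
    even-root-below {r} r<n n∣r²+c with even⊎odd r
    ... | inj₁ r-even = r , r<n , r-even , n∣r²+c
    ... | inj₂ r-odd = n ∸ r , e<n , e-even , subst (_∣ (n ∸ r) * (n ∸ r) + c) r+e≡n
                                                 (reflect-root r (n ∸ r) c (subst (_∣ r * r + c) (sym r+e≡n) n∣r²+c))
      where
      r+e≡n : r + (n ∸ r) ≡ n
      r+e≡n = m+[n∸m]≡n (<⇒≤ r<n)

      e<n : n ∸ r < n
      e<n = subst (n ∸ r <_) r+e≡n (m<n+m (n ∸ r) (>-nonZero⁻¹ r {{odd⇒nonZero r-odd}}))

      e-even : Even (n ∸ r)
      e-even = odd∧odd[+]⇒even r-odd (subst Odd (sym r+e≡n) n-odd)

  square+1<square : ∀ {e n} → e < n → 1 < n → e * e + 1 < n * n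
  square+1<square {e} {n} e<n 1<n = begin-strict
    e * e + 1   <⟨ +-monoʳ-< (e * e) 1<n ⟩
    e * e + n   ≤⟨ +-monoˡ-≤ n (*-monoʳ-≤ e (<⇒≤ e<n)) ⟩
    e * n + n   ≡⟨ +-comm (e * n) n ⟩
    suc e * n   ≤⟨ *-monoˡ-≤ n e<n ⟩
    n * n       ∎
    where open ≤-Reasoning

  ≡3mod4⇒∤square+1 : ∀ n → n ≡ 3 mod 4 → ∀ y → ¬ n ∣ y * y + 1
  ≡3mod4⇒∤square+1 = <-rec _ descent
    where
    descent : ∀ n → (∀ {m} → m < n → m ≡ 3 mod 4 → ∀ y → ¬ m ∣ y * y + 1) →
              n ≡ 3 mod 4 → ∀ y → ¬ n ∣ y * y + 1
    descent n smaller n≡3 y n∣y²+1 with even-root {{≡3mod4⇒nonZero n≡3}} (≡3mod4⇒odd n≡3) y 1 n∣y²+1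
    ... | e , e<n , e-even , divides k e²+1≡kn = smaller k<n k≡3 e (divides n (trans e²+1≡kn (*-comm k n)))
      where
      k≡3 : k ≡ 3 mod 4
      k≡3 = *≡1∧≡3⇒≡3 (mod-trans (≡⇒mod (sym e²+1≡kn)) (mod-+ (even⇒square≡0 e-even) mod-refl)) n≡3

      k<n : k < n
      k<n = *-cancelʳ-< n k n (subst (_< n * n) e²+1≡kn (square+1<square e<n (≡3mod4⇒>1 n≡3)))

  inverse-square≡1 : ∀ {n s} .{{_ : NonZero n}} → Bézout.Identity 1 n s → ∃[ y ] ((y * s) * (y * s) ≡ 1 mod n)
  inverse-square≡1 {n} {s} (Bézout.-+ x y 1+xn≡ys) = y , mod-* ys≡1 ys≡1
    where
    ys≡1 : y * s ≡ 1 mod n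
    ys≡1 = mod-trans (≡⇒mod (sym 1+xn≡ys)) (mod-+ (mod-refl {a = 1}) (mod-*n x))
  inverse-square≡1 {n} {s} (Bézout.+- x y 1+ys≡xn) = y , (begin
    w * w                    ≡⟨ +-identityʳ (w * w) ⟨
    w * w + 2 * 0            ≈⟨ mod-+ mod-refl (mod-*ˡ 2 1+w≡0) ⟨
    w * w + 2 * (1 + w)      ≡⟨ complete-square w ⟩
    (1 + w) * (1 + w) + 1    ≈⟨ mod-+ (mod-* 1+w≡0 1+w≡0) mod-refl ⟩
    1                        ∎)
    where
    open import Relation.Binary.Reasoning.Setoid (mod-setoid n)
    w = y * s
    1+w≡0 : 1 + w ≡ 0 mod n
    1+w≡0 = mod-trans (≡⇒mod 1+ys≡xn) (mod-*n x)
    complete-square : ∀ w → w * w + 2 * (1 + w) ≡ (1 + w) * (1 + w) + 1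
    complete-square = solve-∀

  ≡3mod4∧∣sum-of-squares⇒¬coprime : ∀ {n s t} → n ≡ 3 mod 4 → n ∣ s * s + t * t → ¬ Coprime n s
  ≡3mod4∧∣sum-of-squares⇒¬coprime {n} {s} {t} n≡3 n∣s²+t² n⊥s
    with inverse-square≡1 {{≡3mod4⇒nonZero n≡3}} (coprime-Bézout n⊥s)
  ... | y , ys²≡1 = ≡3mod4⇒∤square+1 n n≡3 (y * t) (mod-resp-∣ (begin
    (y * y) * (s * s + t * t)        ≡⟨ distribute y s t ⟩
    (y * t) * (y * t) + (y * s) * (y * s) ≈⟨ mod-+ mod-refl ys²≡1 ⟩
    (y * t) * (y * t) + 1            ∎) (∣n⇒∣m*n (y * y) n∣s²+t²))
    where
    instance _ = ≡3mod4⇒nonZero n≡3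
    open import Relation.Binary.Reasoning.Setoid (mod-setoid n)
    distribute : ∀ y s t → (y * y) * (s * s + t * t) ≡ (y * t) * (y * t) + (y * s) * (y * s)
    distribute = solve-∀

  prime∧∤⇒coprime : ∀ {p n} → Prime p → ¬ p ∣ n → Coprime p n
  prime∧∤⇒coprime p-prime p∤n (d∣p , d∣n) with prime⇒irreducible p-prime d∣p
  ... | inj₁ d≡1 = d≡1
  ... | inj₂ refl = contradiction d∣n p∤n

  prime≡3mod4∧∣sum-of-squares⇒∣ : ∀ {p s t} → Prime p → p ≡ 3 mod 4 → p ∣ s * s + t * t → p ∣ s
  prime≡3mod4∧∣sum-of-squares⇒∣ {p} {s} {t} p-prime p≡3 p∣s²+t² with p ∣? s
  ... | yes p∣s = p∣s
  ... | no p∤s = ⊥-elim (≡3mod4∧∣sum-of-squares⇒¬coprime {t = t} p≡3 p∣s²+t² (prime∧∤⇒coprime p-prime p∤s))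

  Prime≡3mod4 : ℕ → Set
  Prime≡3mod4 p = Prime p × p ≡ 3 mod 4

  product≡3mod4⇒prime-factor≡3mod4 : ∀ {ps} → All Prime ps → product ps ≡ 3 mod 4 →
                                     ∃[ p ] (Prime≡3mod4 p × p ∣ product ps)
  product≡3mod4⇒prime-factor≡3mod4 [] (%≡⇒mod ())
  product≡3mod4⇒prime-factor≡3mod4 {p ∷ ps} (p-prime ∷ ps-prime) h with *≡3⇒≡3⊎≡3 h
  ... | inj₁ p≡3 = p , (p-prime , p≡3) , m∣m*n (product ps)
  ... | inj₂ rest≡3 with product≡3mod4⇒prime-factor≡3mod4 ps-prime rest≡3
  ...   | q , q₃ , q∣rest = q , q₃ , ∣n⇒∣m*n p q∣rest

  ≡3mod4⇒prime-factor≡3mod4 : ∀ {n} → n ≡ 3 mod 4 → ∃[ p ] (Prime≡3mod4 p × p ∣ n)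
  ≡3mod4⇒prime-factor≡3mod4 {n} n≡3 = subst (λ m → ∃[ p ] (Prime≡3mod4 p × p ∣ m)) (sym isFactorisation)
    (product≡3mod4⇒prime-factor≡3mod4 factorsPrime (subst (_≡ 3 mod 4) isFactorisation n≡3))
    where open PrimeFactorisation (factorise n {{≡3mod4⇒nonZero n≡3}})

  prime∤∧square∣*⇒square∣ : ∀ {p o c} → Prime p → ¬ p ∣ c → p * p ∣ o * c → p * p ∣ o
  prime∤∧square∣*⇒square∣ {p} {o} {c} p-prime p∤c p²∣oc with euclidsLemma o c p-prime (∣-trans (n∣m*n p) p²∣oc)
  ... | inj₂ p∣c = contradiction p∣c p∤c
  ... | inj₁ (divides o₁ refl) with euclidsLemma o₁ c p-prime p∣o₁c
    where
    p∣o₁c : p ∣ o₁ * c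
    p∣o₁c = *-cancelʳ-∣ p {{prime⇒nonZero p-prime}} (subst (p * p ∣_) (rearrange o₁ p c) p²∣oc)
      where
      rearrange : ∀ o₁ p c → o₁ * p * c ≡ o₁ * c * p
      rearrange = solve-∀
  ...   | inj₁ p∣o₁ = *-monoˡ-∣ p p∣o₁
  ...   | inj₂ p∣c = contradiction p∣c p∤c

  prime≡3mod4∧∣sum-of-squares⇒square∣ : ∀ {p s t} → Prime p → p ≡ 3 mod 4 → p ∣ s * s + t * t →
                                        ∃[ s′ ] ∃[ t′ ] (s * s + t * t ≡ (s′ * s′ + t′ * t′) * (p * p))
  prime≡3mod4∧∣sum-of-squares⇒square∣ {p} {s} {t} p-prime p≡3 p∣s²+t²
    with prime≡3mod4∧∣sum-of-squares⇒∣ {s = s} {t = t} p-prime p≡3 p∣s²+t²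
       | prime≡3mod4∧∣sum-of-squares⇒∣ {s = t} {t = s} p-prime p≡3 (subst (p ∣_) (+-comm (s * s) (t * t)) p∣s²+t²)
  ... | divides s′ s≡s′p | divides t′ t≡t′p =
    s′ , t′ , trans (cong₂ (λ a b → a * a + b * b) s≡s′p t≡t′p) (factor-square s′ t′ p)
    where
    factor-square : ∀ s′ t′ p → s′ * p * (s′ * p) + t′ * p * (t′ * p) ≡ (s′ * s′ + t′ * t′) * (p * p)
    factor-square = solve-∀

  remove-square-factor : ∀ {p o c s t} → Prime p → p ≡ 3 mod 4 → ¬ p ∣ c → p ∣ o → o * c ≡ s * s + t * t →
                         ∃[ o′ ] ∃[ s′ ] ∃[ t′ ] (o ≡ o′ * (p * p) × o′ * c ≡ s′ * s′ + t′ * t′)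
  remove-square-factor {p} {o} {c} {s} {t} p-prime p≡3 p∤c p∣o oc≡s²+t²
    with prime≡3mod4∧∣sum-of-squares⇒square∣ {s = s} {t = t} p-prime p≡3 (subst (p ∣_) oc≡s²+t² (∣m⇒∣m*n c p∣o))
  ... | s′ , t′ , s²+t²≡ with prime∤∧square∣*⇒square∣ p-prime p∤c (divides (s′ * s′ + t′ * t′) (trans oc≡s²+t² s²+t²≡))
  ...   | divides o′ o≡o′p² = o′ , s′ , t′ , o≡o′p² , *-cancelʳ-≡ (o′ * c) (s′ * s′ + t′ * t′) (p * p) {{p²≢0}} (begin
      o′ * c * (p * p)               ≡⟨ swap o′ c (p * p) ⟩
      o′ * (p * p) * c               ≡⟨ cong (_* c) o≡o′p² ⟨
      o * c                          ≡⟨ trans oc≡s²+t² s²+t²≡ ⟩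
      (s′ * s′ + t′ * t′) * (p * p)  ∎)
    where
    open ≡-Reasoning
    p²≢0 = m*n≢0 p p {{prime⇒nonZero p-prime}} {{prime⇒nonZero p-prime}}
    swap : ∀ a b c → a * b * c ≡ a * c * b
    swap = solve-∀

  CommonPrime≡3mod4 : ℕ → ℕ → Set
  CommonPrime≡3mod4 a b = ∃[ p ] (Prime≡3mod4 p × p ∣ a × p ∣ b)

  ≡3mod4∧*≡sum-of-squares⇒common-prime : ∀ o {c s t} → o ≡ 3 mod 4 → o * c ≡ s * s + t * t → CommonPrime≡3mod4 o c
  ≡3mod4∧*≡sum-of-squares⇒common-prime = <-rec _ step
    where
    step : ∀ o → (∀ {o′} → o′ < o → ∀ {c s t} → o′ ≡ 3 mod 4 → o′ * c ≡ s * s + t * t → CommonPrime≡3mod4 o′ c) →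
           ∀ {c s t} → o ≡ 3 mod 4 → o * c ≡ s * s + t * t → CommonPrime≡3mod4 o c
    step o smaller {c} {s} {t} o≡3 oc≡s²+t² with ≡3mod4⇒prime-factor≡3mod4 o≡3
    ... | p , p₃@(p-prime , p≡3) , p∣o with p ∣? c
    ...   | yes p∣c = p , p₃ , p∣o , p∣c
    ...   | no p∤c = descend (remove-square-factor {s = s} {t = t} p-prime p≡3 p∤c p∣o oc≡s²+t²)
      where
      descend : ∃[ o′ ] ∃[ s′ ] ∃[ t′ ] (o ≡ o′ * (p * p) × o′ * c ≡ s′ * s′ + t′ * t′) → CommonPrime≡3mod4 o c
      descend (o′ , s′ , t′ , o≡o′p² , o′c≡s′²+t′²) with smaller o′<o {s = s′} {t = t′} o′≡3 o′c≡s′²+t′²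
        where
        o′≡3 : o′ ≡ 3 mod 4
        o′≡3 = *odd-square≡3⇒≡3 (≡3mod4⇒odd p≡3) (subst (_≡ 3 mod 4) o≡o′p² o≡3)

        o′<o : o′ < o
        o′<o = subst (o′ <_) (sym o≡o′p²) (m<m*n o′ (p * p) {{≡3mod4⇒nonZero o′≡3}}
                 (<-≤-trans (≡3mod4⇒>1 p≡3) (m≤m*n p p {{prime⇒nonZero p-prime}})))
      ... | q , q₃ , q∣o′ , q∣c = q , q₃ , subst (q ∣_) (sym o≡o′p²) (∣m⇒∣m*n (p * p) q∣o′) , q∣c

module Representations where

  open Congruence
  open SumsOfTwoSquares
  open import Data.Nat
  open import Data.Nat.Properties
  open import Data.Nat.Divisibility
  open import Data.Nat.Tactic.RingSolver using (solve-∀)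
  open import Data.Product using (_×_; _,_; ∃-syntax)
  open import Data.Sum using (inj₁; inj₂)
  open import Relation.Binary.PropositionalEquality
  open import Relation.Nullary.Decidable using (yes; no)
  open import Relation.Nullary.Negation using (contradiction)
  open import Data.Nat.Primality using (Prime; prime[2]; prime⇒irreducible; euclidsLemma)
  open import Data.Empty using (⊥; ⊥-elim)

  square-≤⇒≤ : ∀ {a b} → a * a ≤ b * b → a ≤ b
  square-≤⇒≤ {a} {b} a²≤b² with a ≤? b
  ... | yes a≤b = a≤b
  ... | no a≰b = contradiction a²≤b² (<⇒≱ (*-mono-< (≰⇒> a≰b) (≰⇒> a≰b)))

  square-<⇒< : ∀ {a b} → a * a < b * b → a < b
  square-<⇒< {a} {b} a²<b² with a <? b
  ... | yes a<b = a<b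
  ... | no a≮b = contradiction a²<b² (≤⇒≯ (*-mono-≤ (≮⇒≥ a≮b) (≮⇒≥ a≮b)))

  odd-square-difference : ∀ {p w n} → Odd p → Odd w → p * p ≡ 8 * n + w * w →
                          ∃[ u ] ∃[ v ] (u + v ≡ p × u * v ≡ 2 * n)
  odd-square-difference {p} {w} {n} p-odd w-odd p²≡8n+w² = u , w + u , u+v≡p , uv≡2n
    where
    w≤p : w ≤ p
    w≤p = square-≤⇒≤ (subst (w * w ≤_) (sym p²≡8n+w²) (m≤n+m (w * w) (8 * n)))

    w+d≡p : w + (p ∸ w) ≡ p
    w+d≡p = m+[n∸m]≡n w≤p

    2∣p-w : 2 ∣ p ∸ w
    2∣p-w = even⇒2∣ (odd∧odd[+]⇒even w-odd (subst Odd (sym w+d≡p) p-odd))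

    u = quotient 2∣p-w

    p≡w+2u : p ≡ w + u * 2
    p≡w+2u = trans (sym w+d≡p) (cong (w +_) (m∣n⇒n≡quotient*m 2∣p-w))

    u+v≡p : u + (w + u) ≡ p
    u+v≡p = trans (regroup w u) (sym p≡w+2u)
      where
      regroup : ∀ w u → u + (w + u) ≡ w + u * 2
      regroup = solve-∀

    uv≡2n : u * (w + u) ≡ 2 * n
    uv≡2n = *-cancelˡ-≡ (u * (w + u)) (2 * n) 4 (+-cancelˡ-≡ (w * w) _ _ (begin
      w * w + 4 * (u * (w + u))     ≡⟨ expand w u ⟩
      (w + u * 2) * (w + u * 2)     ≡⟨ cong (λ a → a * a) p≡w+2u ⟨
      p * p                         ≡⟨ p²≡8n+w² ⟩
      8 * n + w * w                 ≡⟨ regroup w n ⟩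
      w * w + 4 * (2 * n)           ∎))
      where
      open ≡-Reasoning
      expand : ∀ w u → w * w + 4 * (u * (w + u)) ≡ (w + u * 2) * (w + u * 2)
      expand = solve-∀
      regroup : ∀ w n → 8 * n + w * w ≡ w * w + 4 * (2 * n)
      regroup = solve-∀

  odd∧even-split : ∀ {o e p n} → Odd o → Even e → o + e ≡ p → o * e ≡ 2 * n →
                   ∃[ o ] ∃[ c ] (Odd o × o + 2 * c ≡ p × o * c ≡ n)
  odd∧even-split {o} {e} {p} {n} o-odd e-even o+e≡p oe≡2n = o , c , o-odd , o+2c≡p , oc≡n
    where
    2∣e = even⇒2∣ e-even
    c = quotient 2∣e

    e≡2c : e ≡ 2 * c
    e≡2c = trans (m∣n⇒n≡quotient*m 2∣e) (*-comm c 2)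

    o+2c≡p : o + 2 * c ≡ p
    o+2c≡p = trans (cong (o +_) (sym e≡2c)) o+e≡p

    oc≡n : o * c ≡ n
    oc≡n = *-cancelˡ-≡ (o * c) n 2 (trans (left-comm 2 o c) (trans (cong (o *_) (sym e≡2c)) oe≡2n))
      where
      left-comm : ∀ a b c → a * (b * c) ≡ b * (a * c)
      left-comm = solve-∀

  odd-split : ∀ {p u v n} → Odd p → u + v ≡ p → u * v ≡ 2 * n →
              ∃[ o ] ∃[ c ] (Odd o × o + 2 * c ≡ p × o * c ≡ n)
  odd-split {p} {u} {v} p-odd u+v≡p uv≡2n with odd-+ {u} {v} (subst Odd (sym u+v≡p) p-odd)
  ... | inj₁ (u-odd , v-even) = odd∧even-split u-odd v-even u+v≡p uv≡2n
  ... | inj₂ (u-even , v-odd) = odd∧even-split v-odd u-even (trans (+-comm v u) u+v≡p) (trans (*-comm v u) uv≡2n)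

  -- The congruence p + 2(x² + y²) ≡ 3 (mod 4) covers both parts of the theorem (p ≡ 3 with x² + y² even,
  -- p ≡ 1 with x² + y² odd) and is exactly what makes o ≡ 3 (mod 4).
  p²≡8[x²+y²]+w²⇒common-prime : ∀ {p w x y} → Odd p → Odd w → p * p ≡ 8 * (x * x + y * y) + w * w →
    p + 2 * (x * x + y * y) ≡ 3 mod 4 →
    ∃[ o ] ∃[ c ] (o + 2 * c ≡ p × o * c ≡ x * x + y * y × CommonPrime≡3mod4 o p)
  p²≡8[x²+y²]+w²⇒common-prime {p} {w} {x} {y} p-odd w-odd p²≡ p+2n≡3
    with odd-square-difference {n = x * x + y * y} p-odd w-odd p²≡
  ... | u , v , u+v≡p , uv≡2n with odd-split {u = u} {v = v} {n = x * x + y * y} p-odd u+v≡p uv≡2n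
  ... | o , c , o-odd , o+2c≡p , oc≡n =
    o , c , o+2c≡p , oc≡n , widen (≡3mod4∧*≡sum-of-squares⇒common-prime o {s = x} {t = y} o≡3 oc≡n)
    where
    widen : CommonPrime≡3mod4 o c → CommonPrime≡3mod4 o p
    widen (q , q₃ , q∣o , q∣c) = q , q₃ , q∣o , subst (q ∣_) o+2c≡p (∣m∣n⇒∣m+n q∣o (∣n⇒∣m*n 2 q∣c))

    o≡3 : o ≡ 3 mod 4
    o≡3 = odd∧[o+2c+2oc≡3]⇒≡3 o-odd (subst₂ (λ a b → a + 2 * b ≡ 3 mod 4) (sym o+2c≡p) (sym oc≡n) p+2n≡3)

  parity-split : ∀ {g h m} → Odd (g + h) → m ≡ 2 * (g * g + h * h) →
                 ∃[ f ] ∃[ e ] (Odd f × Even e × m ≡ 2 * (f * f + e * e))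
  parity-split {g} {h} g+h-odd m≡ with odd-+ {g} {h} g+h-odd
  ... | inj₁ (g-odd , h-even) = g , h , g-odd , h-even , m≡
  ... | inj₂ (g-even , h-odd) = h , g , h-odd , g-even , trans m≡ (cong (2 *_) (+-comm (g * g) (h * h)))

  sum-of-odd-squares≤ : ∀ {a b} → b ≤ a → Odd a → Odd b →
                        ∃[ f ] ∃[ e ] (Odd f × Even e × a * a + b * b ≡ 2 * (f * f + e * e))
  sum-of-odd-squares≤ {a} {b} b≤a a-odd b-odd = parity-split {g = b + s} {h = s} (subst Odd a≡b+s+s a-odd) a²+b²≡
    where
    b+d≡a : b + (a ∸ b) ≡ a
    b+d≡a = m+[n∸m]≡n b≤a

    2∣a-b : 2 ∣ a ∸ b
    2∣a-b = even⇒2∣ (odd∧odd[+]⇒even b-odd (subst Odd (sym b+d≡a) a-odd))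

    s = quotient 2∣a-b

    a≡b+2s : a ≡ b + s * 2
    a≡b+2s = trans (sym b+d≡a) (cong (b +_) (m∣n⇒n≡quotient*m 2∣a-b))

    a≡b+s+s : a ≡ b + s + s
    a≡b+s+s = trans a≡b+2s (regroup b s)
      where
      regroup : ∀ b s → b + s * 2 ≡ b + s + s
      regroup = solve-∀

    a²+b²≡ : a * a + b * b ≡ 2 * ((b + s) * (b + s) + s * s)
    a²+b²≡ = trans (cong (λ a → a * a + b * b) a≡b+2s) (halve b s)
      where
      halve : ∀ b s → (b + s * 2) * (b + s * 2) + b * b ≡ 2 * ((b + s) * (b + s) + s * s)
      halve = solve-∀

  sum-of-odd-squares : ∀ {a b} → Odd a → Odd b →
                       ∃[ f ] ∃[ e ] (Odd f × Even e × a * a + b * b ≡ 2 * (f * f + e * e))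
  sum-of-odd-squares {a} {b} a-odd b-odd with ≤-total b a
  ... | inj₁ b≤a = sum-of-odd-squares≤ b≤a a-odd b-odd
  ... | inj₂ a≤b with sum-of-odd-squares≤ a≤b b-odd a-odd
  ...   | f , e , f-odd , e-even , b²+a²≡ = f , e , f-odd , e-even , trans (+-comm (a * a) (b * b)) b²+a²≡

  2p²≡8x²+a²+b²⇒p²≡4x²+f²+e² : ∀ {p x a b} → Odd a → Odd b → 2 * (p * p) ≡ 8 * (x * x) + a * a + b * b →
                                 ∃[ f ] ∃[ e ] (Odd f × Even e × p * p ≡ 4 * (x * x) + f * f + e * e)
  2p²≡8x²+a²+b²⇒p²≡4x²+f²+e² {p} {x} {a} {b} a-odd b-odd 2p²≡ with sum-of-odd-squares a-odd b-odd
  ... | f , e , f-odd , e-even , a²+b²≡ = f , e , f-odd , e-even , *-cancelˡ-≡ _ _ 2 (begin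
    2 * (p * p)                          ≡⟨ 2p²≡ ⟩
    8 * (x * x) + a * a + b * b          ≡⟨ +-assoc (8 * (x * x)) (a * a) (b * b) ⟩
    8 * (x * x) + (a * a + b * b)        ≡⟨ cong (8 * (x * x) +_) a²+b²≡ ⟩
    8 * (x * x) + 2 * (f * f + e * e)    ≡⟨ halve x f e ⟩
    2 * (4 * (x * x) + f * f + e * e)    ∎)
    where
    open ≡-Reasoning
    halve : ∀ x f e → 8 * (x * x) + 2 * (f * f + e * e) ≡ 2 * (4 * (x * x) + f * f + e * e)
    halve = solve-∀

  p²≡4x²+f²+e²⇒e≡2x : ∀ {p x f e} → Odd p → Odd f → p * p ≡ 4 * (x * x) + f * f + e * e → e ≡ 2 * x mod 4
  p²≡4x²+f²+e²⇒e≡2x {p} {x} {f} {e} p-odd f-odd p²≡ = [4x²+1+e²≡1]⇒e≡2x {x} {e} (begin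
    4 * (x * x) + 1 + e * e           ≈⟨ mod-+ (mod-+ (mod-refl {a = 4 * (x * x)}) (odd⇒square≡1 f-odd))
                                               (mod-refl {a = e * e}) ⟨
    4 * (x * x) + f * f + e * e       ≡⟨ p²≡ ⟨
    p * p                             ≈⟨ odd⇒square≡1 p-odd ⟩
    1                                 ∎)
    where open import Relation.Binary.Reasoning.Setoid (mod-setoid 8)

  u+e≡p⇒u≡3 : ∀ {u e p x} → u + e ≡ p → e ≡ 2 * x mod 4 → p + 2 * x ≡ 3 mod 4 → u ≡ 3 mod 4
  u+e≡p⇒u≡3 {u} {e} {p} {x} u+e≡p e≡2x p+2x≡3 = begin
    u                       ≡⟨ +-identityʳ u ⟨
    u + 0                   ≈⟨ mod-+ mod-refl (mod-*n x) ⟨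
    u + x * 4               ≡⟨ regroup u x ⟩
    u + 2 * x + 2 * x       ≈⟨ mod-+ (mod-+ (mod-refl {a = u}) e≡2x) mod-refl ⟨
    u + e + 2 * x           ≡⟨ cong (_+ 2 * x) u+e≡p ⟩
    p + 2 * x               ≈⟨ p+2x≡3 ⟩
    3                       ∎
    where
    open import Relation.Binary.Reasoning.Setoid (mod-setoid 4)
    regroup : ∀ u x → u + x * 4 ≡ u + 2 * x + 2 * x
    regroup = solve-∀

  ≡3mod4∣prime⇒≡ : ∀ {q p} → Prime p → q ≡ 3 mod 4 → q ∣ p → q ≡ p
  ≡3mod4∣prime⇒≡ p-prime q≡3 q∣p with prime⇒irreducible p-prime q∣p
  ... | inj₂ q≡p = q≡p
  ... | inj₁ refl with q≡3
  ...   | %≡⇒mod ()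

  common-prime-shift : ∀ {u e p} → u + e ≡ p → CommonPrime≡3mod4 u (p + e) → CommonPrime≡3mod4 u p
  common-prime-shift {u} {e} {p} u+e≡p (q , q₃@(q-prime , q≡3) , q∣u , q∣p+e) = q , q₃ , q∣u , q∣p
    where
    q∣2p : q ∣ 2 * p
    q∣2p = subst (q ∣_) u+[p+e]≡2p (∣m∣n⇒∣m+n q∣u q∣p+e)
      where
      open ≡-Reasoning
      regroup : ∀ u e → u + (u + e + e) ≡ 2 * (u + e)
      regroup = solve-∀
      u+[p+e]≡2p : u + (p + e) ≡ 2 * p
      u+[p+e]≡2p = begin
        u + (p + e)          ≡⟨ cong (λ a → u + (a + e)) u+e≡p ⟨
        u + (u + e + e)      ≡⟨ regroup u e ⟩
        2 * (u + e)          ≡⟨ cong (2 *_) u+e≡p ⟩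
        2 * p                ∎

    q∣p : q ∣ p
    q∣p with euclidsLemma 2 p q-prime q∣2p
    ... | inj₂ q∣p = q∣p
    ... | inj₁ q∣2 with subst (_≡ 3 mod 4) (≡3mod4∣prime⇒≡ prime[2] q≡3 q∣2) q≡3
    ...   | %≡⇒mod ()

  -- Likewise p + 2x ≡ 3 (mod 4) covers p ≡ 3 with x even and p ≡ 1 with x odd; since e ≡ 2x (mod 4),
  -- it makes u = p − e ≡ 3 (mod 4).
  2p²≡8x²+a²+b²⇒common-prime : ∀ {p x a b} → Odd p → Odd a → Odd b → 2 * (p * p) ≡ 8 * (x * x) + a * a + b * b →
    p + 2 * x ≡ 3 mod 4 →
    ∃[ u ] ∃[ e ] ∃[ f ] (u + e ≡ p × Odd f × u * (p + e) ≡ 2 * x * (2 * x) + f * f × CommonPrime≡3mod4 u p)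
  2p²≡8x²+a²+b²⇒common-prime {p} {x} p-odd a-odd b-odd 2p²≡ p+2x≡3
    with 2p²≡8x²+a²+b²⇒p²≡4x²+f²+e² {p = p} {x = x} a-odd b-odd 2p²≡
  ... | f , e , f-odd , _ , p²≡ = p ∸ e , e , f , u+e≡p , f-odd , u[p+e]≡ ,
    common-prime-shift u+e≡p (≡3mod4∧*≡sum-of-squares⇒common-prime (p ∸ e) {s = 2 * x} {t = f} u≡3 u[p+e]≡)
    where
    e<p : e < p
    e<p = square-<⇒< (subst (e * e <_) (sym p²≡) (m<n+m (e * e) (<-≤-trans f²>0 (m≤n+m (f * f) (4 * (x * x))))))
      where
      f²>0 : 0 < f * f
      f²>0 = >-nonZero⁻¹ (f * f) {{m*n≢0 f f {{odd⇒nonZero f-odd}} {{odd⇒nonZero f-odd}}}}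

    u = p ∸ e

    u+e≡p : u + e ≡ p
    u+e≡p = m∸n+n≡m (<⇒≤ e<p)

    u≡3 : u ≡ 3 mod 4
    u≡3 = u+e≡p⇒u≡3 {x = x} u+e≡p (p²≡4x²+f²+e²⇒e≡2x {x = x} {e = e} p-odd f-odd p²≡) p+2x≡3

    u[p+e]≡ : u * (p + e) ≡ 2 * x * (2 * x) + f * f
    u[p+e]≡ = +-cancelʳ-≡ (e * e) _ _ (begin
      u * (p + e) + e * e                  ≡⟨ cong (λ q → u * (q + e) + e * e) u+e≡p ⟨
      u * (u + e + e) + e * e              ≡⟨ complete-square u e ⟩
      (u + e) * (u + e)                    ≡⟨ cong (λ q → q * q) u+e≡p ⟩
      p * p                                ≡⟨ p²≡ ⟩
      4 * (x * x) + f * f + e * e          ≡⟨ cong (λ q → q + f * f + e * e) (double-square x) ⟩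
      2 * x * (2 * x) + f * f + e * e      ∎)
      where
      open ≡-Reasoning
      complete-square : ∀ u e → u * (u + e + e) + e * e ≡ (u + e) * (u + e)
      complete-square = solve-∀
      double-square : ∀ x → 4 * (x * x) ≡ 2 * x * (2 * x)
      double-square = solve-∀

  ≡1∧≡3mod4⇒⊥ : ∀ {a} → a ≡ 1 mod 4 → a ≡ 3 mod 4 → ⊥
  ≡1∧≡3mod4⇒⊥ a≡1 a≡3 with mod-trans (mod-sym a≡1) a≡3
  ... | %≡⇒mod ()

  prime-factors≡1mod4⇒≡1mod4 : ∀ {n} → (∀ q → Prime q → q ∣ n → q ≡ 1 mod 4) → Odd n → n ≡ 1 mod 4
  prime-factors≡1mod4⇒≡1mod4 factors≡1 n-odd with odd⇒≡1⊎≡3 n-odd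
  ... | inj₁ n≡1 = n≡1
  ... | inj₂ n≡3 with ≡3mod4⇒prime-factor≡3mod4 n≡3
  ...   | q , (q-prime , q≡3) , q∣n = ⊥-elim (≡1∧≡3mod4⇒⊥ (factors≡1 q q-prime q∣n) q≡3)

  prime≡3mod4-square≢sum-of-squares : ∀ {p a b} .{{_ : NonZero a}} .{{_ : NonZero b}} → Prime p → p ≡ 3 mod 4 →
                                      p * p ≢ a * a + b * b
  prime≡3mod4-square≢sum-of-squares {p} {a} {b} p-prime p≡3 p²≡a²+b² = <-irrefl refl (begin-strict
    p * p           ≤⟨ *-mono-≤ p≤a p≤a ⟩
    a * a           <⟨ m<m+n (a * a) (>-nonZero⁻¹ (b * b) {{m*n≢0 b b}}) ⟩
    a * a + b * b   ≡⟨ p²≡a²+b² ⟨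
    p * p           ∎)
    where
    open ≤-Reasoning
    p≤a : p ≤ a
    p≤a = ∣⇒≤ (prime≡3mod4∧∣sum-of-squares⇒∣ {t = b} p-prime p≡3 (subst (p ∣_) p²≡a²+b² (n∣m*n p)))

  ∣∧+≡⇒≡0 : ∀ {u e p} .{{_ : NonZero u}} → p ∣ u → u + e ≡ p → e ≡ 0
  ∣∧+≡⇒≡0 {u} {e} {p} p∣u u+e≡p = n≤0⇒n≡0 (+-cancelˡ-≤ u e 0 (begin
    u + e   ≡⟨ u+e≡p ⟩
    p       ≤⟨ ∣⇒≤ p∣u ⟩
    u       ≡⟨ +-identityʳ u ⟨
    u + 0   ∎))
    where open ≤-Reasoning

  prime≡3mod4⇒p²≢8[x²+y²]+w² : ∀ {p w x y} → Prime p → p ≡ 3 mod 4 → Odd w → Even (x * x + y * y) →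
                                0 < x * x + y * y → p * p ≢ 8 * (x * x + y * y) + w * w
  prime≡3mod4⇒p²≢8[x²+y²]+w² {p} {w} {x} {y} p-prime p≡3 w-odd n-even n>0 p²≡ =
    absurd (p²≡8[x²+y²]+w²⇒common-prime {x = x} {y = y} (≡3mod4⇒odd p≡3) w-odd p²≡ (mod-+ p≡3 (mod2⇒double-mod4 n-even)))
    where
    absurd : ∃[ o ] ∃[ c ] (o + 2 * c ≡ p × o * c ≡ x * x + y * y × CommonPrime≡3mod4 o p) → ⊥
    absurd (o , c , o+2c≡p , oc≡n , q , (_ , q≡3) , q∣o , q∣p) = <⇒≱ o<p (∣⇒≤ p∣o)
      where
      oc≢0 : NonZero (o * c)
      oc≢0 = >-nonZero (subst (0 <_) (sym oc≡n) n>0)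

      instance
        o≢0 : NonZero o
        o≢0 = m*n≢0⇒m≢0 o {{oc≢0}}
        c≢0 : NonZero c
        c≢0 = m*n≢0⇒n≢0 o {{oc≢0}}

      p∣o : p ∣ o
      p∣o = subst (_∣ o) (≡3mod4∣prime⇒≡ p-prime q≡3 q∣p) q∣o

      o<p : o < p
      o<p = subst (o <_) o+2c≡p (m<m+n o (>-nonZero⁻¹ (2 * c) {{m*n≢0 2 c}}))

  prime-factors≡1mod4⇒p²≢8[x²+y²]+w² : ∀ {p w x y} → (∀ q → Prime q → q ∣ p → q ≡ 1 mod 4) → Odd p → Odd w →
                                        Odd x → Even y → p * p ≢ 8 * (x * x + y * y) + w * w
  prime-factors≡1mod4⇒p²≢8[x²+y²]+w² {p} {w} {x} {y} factors≡1 p-odd w-odd x-odd y-even p²≡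
    = absurd (p²≡8[x²+y²]+w²⇒common-prime {x = x} {y = y} p-odd w-odd p²≡ (mod-+ p≡1 (mod2⇒double-mod4 n-odd)))
    where
    p≡1 : p ≡ 1 mod 4
    p≡1 = prime-factors≡1mod4⇒≡1mod4 factors≡1 p-odd
    n-odd : Odd (x * x + y * y)
    n-odd = mod-+ (mod-* x-odd x-odd) (mod-* y-even y-even)
    absurd : ∃[ o ] ∃[ c ] (o + 2 * c ≡ p × o * c ≡ x * x + y * y × CommonPrime≡3mod4 o p) → ⊥
    absurd (_ , _ , _ , _ , q , (q-prime , q≡3) , _ , q∣p) = ≡1∧≡3mod4⇒⊥ (factors≡1 q q-prime q∣p) q≡3

  prime≡3mod4⇒2p²≢8x²+a²+b² : ∀ {p x a b} → Prime p → p ≡ 3 mod 4 → Odd a → Odd b → Even x → x ≢ 0 →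
                               2 * (p * p) ≢ 8 * (x * x) + a * a + b * b
  prime≡3mod4⇒2p²≢8x²+a²+b² {p} {x} p-prime p≡3 a-odd b-odd x-even x≢0 2p²≡ =
    absurd (2p²≡8x²+a²+b²⇒common-prime {x = x} (≡3mod4⇒odd p≡3) a-odd b-odd 2p²≡ (mod-+ p≡3 (mod2⇒double-mod4 x-even)))
    where
    absurd : ∃[ u ] ∃[ e ] ∃[ f ] (u + e ≡ p × Odd f × u * (p + e) ≡ 2 * x * (2 * x) + f * f × CommonPrime≡3mod4 u p) → ⊥
    absurd (u , e , f , u+e≡p , f-odd , u[p+e]≡ , q , (_ , q≡3) , q∣u , q∣p) =
      prime≡3mod4-square≢sum-of-squares p-prime p≡3 p²≡[2x]²+f²
      where
      [2x]²+f²>0 : 0 < 2 * x * (2 * x) + f * f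
      [2x]²+f²>0 = <-≤-trans (>-nonZero⁻¹ (f * f) {{m*n≢0 f f {{odd⇒nonZero f-odd}} {{odd⇒nonZero f-odd}}}})
                             (m≤n+m (f * f) (2 * x * (2 * x)))

      instance
        2x≢0 : NonZero (2 * x)
        2x≢0 = m*n≢0 2 x {{_}} {{≢-nonZero x≢0}}
        f≢0 : NonZero f
        f≢0 = odd⇒nonZero f-odd
        u≢0 : NonZero u
        u≢0 = m*n≢0⇒m≢0 u {{subst NonZero (sym u[p+e]≡) (>-nonZero [2x]²+f²>0)}}

      e≡0 : e ≡ 0
      e≡0 = ∣∧+≡⇒≡0 (subst (_∣ u) (≡3mod4∣prime⇒≡ p-prime q≡3 q∣p) q∣u) u+e≡p

      u≡p : u ≡ p
      u≡p = trans (sym (+-identityʳ u)) (trans (cong (u +_) (sym e≡0)) u+e≡p)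

      p²≡[2x]²+f² : p * p ≡ 2 * x * (2 * x) + f * f
      p²≡[2x]²+f² = begin
        p * p                    ≡⟨ cong (p *_) (+-identityʳ p) ⟨
        p * (p + 0)              ≡⟨ cong₂ (λ u e → u * (p + e)) u≡p e≡0 ⟨
        u * (p + e)              ≡⟨ u[p+e]≡ ⟩
        2 * x * (2 * x) + f * f  ∎
        where open ≡-Reasoning

  prime-factors≡1mod4⇒2p²≢8x²+a²+b² : ∀ {p x a b} → (∀ q → Prime q → q ∣ p → q ≡ 1 mod 4) → Odd p → Odd a → Odd b →
                                       Odd x → 2 * (p * p) ≢ 8 * (x * x) + a * a + b * b
  prime-factors≡1mod4⇒2p²≢8x²+a²+b² {p} {x} factors≡1 p-odd a-odd b-odd x-odd 2p²≡
    = absurd (2p²≡8x²+a²+b²⇒common-prime {x = x} p-odd a-odd b-odd 2p²≡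
               (mod-+ (prime-factors≡1mod4⇒≡1mod4 factors≡1 p-odd) (mod2⇒double-mod4 x-odd)))
    where
    absurd : ∃[ u ] ∃[ e ] ∃[ f ] (u + e ≡ p × Odd f × u * (p + e) ≡ 2 * x * (2 * x) + f * f × CommonPrime≡3mod4 u p) → ⊥
    absurd (_ , _ , _ , _ , _ , _ , q , (q-prime , q≡3) , _ , q∣p) = ≡1∧≡3mod4⇒⊥ (factors≡1 q q-prime q∣p) q≡3

module IntegerForms where

  open import Defs using (T)
  open Congruence using (Even; Odd; even⇒2∣; 2∣⇒even; ¬2∣⇒odd; even[n*[n+1]]; odd[2n+1])
  open import Data.Integer
  open import Data.Integer.Properties
  open import Data.Integer.Divisibility using () renaming (_∣_ to _∣ᵤ_)
  open import Data.Integer.Divisibility.Signed using (∣ᵤ⇒∣; ∣⇒∣ᵤ; ∣m∣n⇒∣m+n; ∣m⇒∣m*n; ∣-refl) renaming (_∣_ to _∣ₛ_)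
  open import Data.Integer.Tactic.RingSolver using (solve-∀)
  open import Data.Nat as ℕ using (ℕ)
  open import Data.Nat.DivMod using (m*n/n≡m)
  open import Data.Nat.Divisibility using (quotient; m∣n⇒n≡quotient*m) renaming (_∣_ to _∣ℕ_)
  open import Data.Product using (_,_; ∃-syntax)
  open import Relation.Binary.PropositionalEquality
  open import Relation.Nullary.Negation using (¬_)

  consecutive-product : ∀ z → ∃[ n ] (z * (z + + 1) ≡ + (n ℕ.* (n ℕ.+ 1)))
  consecutive-product (+ n) = n , sym (pos-* n (n ℕ.+ 1))
  consecutive-product -[1+ n ] = n , trans (reflect (+ n)) (sym (pos-* n (n ℕ.+ 1)))
    where
    reflect : ∀ y → - (+ 1 + y) * (- (+ 1 + y) + + 1) ≡ y * (y + + 1)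
    reflect = solve-∀

  8T+1≡[2z+1]² : ∀ z → + 8 * T z + + 1 ≡ (+ 2 * z + + 1) * (+ 2 * z + + 1)
  8T+1≡[2z+1]² z with consecutive-product z
  ... | n , z[z+1]≡ = begin
    + 8 * T z + + 1                        ≡⟨ cong (λ t → + 8 * t + + 1) Tz≡t ⟩
    + 8 * + t + + 1                        ≡⟨ regroup (+ t) ⟩
    + 4 * (+ t * + 2) + + 1                ≡⟨ cong (λ a → + 4 * a + + 1) (trans (sym (pos-* t 2)) (sym z[z+1]≡2t)) ⟩
    + 4 * (z * (z + + 1)) + + 1            ≡⟨ complete-square z ⟩
    (+ 2 * z + + 1) * (+ 2 * z + + 1)      ∎
    where
    open ≡-Reasoning
    2∣n[n+1] = even⇒2∣ (even[n*[n+1]] n)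
    t = quotient 2∣n[n+1]
    z[z+1]≡2t : z * (z + + 1) ≡ + (t ℕ.* 2)
    z[z+1]≡2t = trans z[z+1]≡ (cong +_ (m∣n⇒n≡quotient*m 2∣n[n+1]))
    Tz≡t : T z ≡ + t
    Tz≡t = trans (cong (_/ + 2) z[z+1]≡2t) (trans (*-identityˡ _) (cong +_ (m*n/n≡m t 2)))
    regroup : ∀ t → + 8 * t + + 1 ≡ + 4 * (t * + 2) + + 1
    regroup = solve-∀
    complete-square : ∀ z → + 4 * (z * (z + + 1)) + + 1 ≡ (+ 2 * z + + 1) * (+ 2 * z + + 1)
    complete-square = solve-∀

  i*i≡+∣i∣*∣i∣ : ∀ i → i * i ≡ + (∣ i ∣ ℕ.* ∣ i ∣)
  i*i≡+∣i∣*∣i∣ (+ n) = sym (pos-* n n)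
  i*i≡+∣i∣*∣i∣ -[1+ n ] = refl

  oddRoot : ℤ → ℕ
  oddRoot z = ∣ + 2 * z + + 1 ∣

  8T+1≡oddRoot² : ∀ z → + 8 * T z + + 1 ≡ + (oddRoot z ℕ.* oddRoot z)
  8T+1≡oddRoot² z = trans (8T+1≡[2z+1]² z) (i*i≡+∣i∣*∣i∣ (+ 2 * z + + 1))

  oddRoot[+n]≡2n+1 : ∀ n → oddRoot (+ n) ≡ 2 ℕ.* n ℕ.+ 1
  oddRoot[+n]≡2n+1 n = cong (λ a → ∣ a + + 1 ∣) (sym (pos-* 2 n))

  oddRoot-odd : ∀ z → Odd (oddRoot z)
  oddRoot-odd (+ n) = subst Odd (sym (oddRoot[+n]≡2n+1 n)) (odd[2n+1] n)
  oddRoot-odd -[1+ n ] = subst Odd (sym oddRoot≡) (oddRoot-odd (+ n))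
    where
    reflect : ∀ y → + 2 * - (+ 1 + y) + + 1 ≡ - (+ 2 * y + + 1)
    reflect = solve-∀
    oddRoot≡ : oddRoot -[1+ n ] ≡ oddRoot (+ n)
    oddRoot≡ = trans (cong ∣_∣ (reflect (+ n))) (∣-i∣≡∣i∣ (+ 2 * + n + + 1))

  x²+y²≡+[∣x∣²+∣y∣²] : ∀ x y → x * x + y * y ≡ + (∣ x ∣ ℕ.* ∣ x ∣ ℕ.+ ∣ y ∣ ℕ.* ∣ y ∣)
  x²+y²≡+[∣x∣²+∣y∣²] x y =
    trans (cong₂ _+_ (i*i≡+∣i∣*∣i∣ x) (i*i≡+∣i∣*∣i∣ y)) (sym (pos-+ (∣ x ∣ ℕ.* ∣ x ∣) (∣ y ∣ ℕ.* ∣ y ∣)))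

  T≡sum-of-squares+T⇒ℕ : ∀ m x y z → T (+ m) ≡ x * x + y * y + T z →
    (2 ℕ.* m ℕ.+ 1) ℕ.* (2 ℕ.* m ℕ.+ 1) ≡ 8 ℕ.* (∣ x ∣ ℕ.* ∣ x ∣ ℕ.+ ∣ y ∣ ℕ.* ∣ y ∣) ℕ.+ oddRoot z ℕ.* oddRoot z
  T≡sum-of-squares+T⇒ℕ m x y z Tm≡ = +-injective (begin
    + (P ℕ.* P)                                   ≡⟨ cong (λ a → + (a ℕ.* a)) (oddRoot[+n]≡2n+1 m) ⟨
    + (oddRoot (+ m) ℕ.* oddRoot (+ m))            ≡⟨ 8T+1≡oddRoot² (+ m) ⟨
    + 8 * T (+ m) + + 1                            ≡⟨ cong (λ t → + 8 * t + + 1) Tm≡ ⟩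
    + 8 * (x * x + y * y + T z) + + 1              ≡⟨ regroup (x * x + y * y) (T z) ⟩
    + 8 * (x * x + y * y) + (+ 8 * T z + + 1)      ≡⟨ cong₂ (λ a b → + 8 * a + b) (x²+y²≡+[∣x∣²+∣y∣²] x y) (8T+1≡oddRoot² z) ⟩
    + 8 * + N + + (W ℕ.* W)                        ≡⟨ cong (_+ + (W ℕ.* W)) (pos-* 8 N) ⟨
    + (8 ℕ.* N) + + (W ℕ.* W)                      ≡⟨ pos-+ (8 ℕ.* N) (W ℕ.* W) ⟨
    + (8 ℕ.* N ℕ.+ W ℕ.* W)                        ∎)
    where
    open ≡-Reasoning
    P = 2 ℕ.* m ℕ.+ 1
    N = ∣ x ∣ ℕ.* ∣ x ∣ ℕ.+ ∣ y ∣ ℕ.* ∣ y ∣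
    W = oddRoot z
    regroup : ∀ n t → + 8 * (n + t) + + 1 ≡ + 8 * n + (+ 8 * t + + 1)
    regroup = solve-∀

  2T≡square+T+T⇒ℕ : ∀ m x y z → + 2 * T (+ m) ≡ x * x + T y + T z →
    2 ℕ.* ((2 ℕ.* m ℕ.+ 1) ℕ.* (2 ℕ.* m ℕ.+ 1)) ≡
      8 ℕ.* (∣ x ∣ ℕ.* ∣ x ∣) ℕ.+ oddRoot y ℕ.* oddRoot y ℕ.+ oddRoot z ℕ.* oddRoot z
  2T≡square+T+T⇒ℕ m x y z 2Tm≡ = +-injective (begin
    + (2 ℕ.* (P ℕ.* P))                                     ≡⟨ pos-* 2 (P ℕ.* P) ⟩
    + 2 * + (P ℕ.* P)                                        ≡⟨ cong (λ a → + 2 * + (a ℕ.* a)) (oddRoot[+n]≡2n+1 m) ⟨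
    + 2 * + (oddRoot (+ m) ℕ.* oddRoot (+ m))                 ≡⟨ cong (+ 2 *_) (8T+1≡oddRoot² (+ m)) ⟨
    + 2 * (+ 8 * T (+ m) + + 1)                              ≡⟨ regroup (T (+ m)) ⟩
    + 8 * (+ 2 * T (+ m)) + + 2                              ≡⟨ cong (λ t → + 8 * t + + 2) 2Tm≡ ⟩
    + 8 * (x * x + T y + T z) + + 2                          ≡⟨ distribute (x * x) (T y) (T z) ⟩
    + 8 * (x * x) + (+ 8 * T y + + 1) + (+ 8 * T z + + 1)    ≡⟨ cong₂ _+_ (cong₂ (λ a b → + 8 * a + b)
                                                                   (i*i≡+∣i∣*∣i∣ x) (8T+1≡oddRoot² y)) (8T+1≡oddRoot² z) ⟩
    + 8 * + X² + + A² + + B²                                 ≡⟨ cong (λ a → a + + A² + + B²) (pos-* 8 X²) ⟨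
    + (8 ℕ.* X²) + + A² + + B²                               ≡⟨ cong (_+ + B²) (pos-+ (8 ℕ.* X²) A²) ⟨
    + (8 ℕ.* X² ℕ.+ A²) + + B²                               ≡⟨ pos-+ (8 ℕ.* X² ℕ.+ A²) B² ⟨
    + (8 ℕ.* X² ℕ.+ A² ℕ.+ B²)                               ∎)
    where
    open ≡-Reasoning
    P = 2 ℕ.* m ℕ.+ 1
    X² = ∣ x ∣ ℕ.* ∣ x ∣
    A² = oddRoot y ℕ.* oddRoot y
    B² = oddRoot z ℕ.* oddRoot z
    regroup : ∀ t → + 2 * (+ 8 * t + + 1) ≡ + 8 * (+ 2 * t) + + 2
    regroup = solve-∀
    distribute : ∀ a b c → + 8 * (a + b + c) + + 2 ≡ + 8 * a + (+ 8 * b + + 1) + (+ 8 * c + + 1)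
    distribute = solve-∀

  +2∣⇒even : ∀ x → + 2 ∣ᵤ x → Even ∣ x ∣
  +2∣⇒even x = 2∣⇒even

  ¬+2∣⇒odd : ∀ x → ¬ (+ 2 ∣ᵤ x) → Odd ∣ x ∣
  ¬+2∣⇒odd x = ¬2∣⇒odd

  +2∣x-y⇒even[∣x∣²+∣y∣²] : ∀ x y → + 2 ∣ᵤ x - y → Even (∣ x ∣ ℕ.* ∣ x ∣ ℕ.+ ∣ y ∣ ℕ.* ∣ y ∣)
  +2∣x-y⇒even[∣x∣²+∣y∣²] x y 2∣x-y = 2∣⇒even (subst (λ a → 2 ∣ℕ ∣ a ∣) (x²+y²≡+[∣x∣²+∣y∣²] x y) (∣⇒∣ᵤ 2∣x²+y²))
    where
    expand : ∀ x y → x * x + y * y ≡ (x - y) * (x - y) + + 2 * (x * y)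
    expand = solve-∀
    2∣x²+y² : + 2 ∣ₛ x * x + y * y
    2∣x²+y² = subst (+ 2 ∣ₛ_) (sym (expand x y))
                (∣m∣n⇒∣m+n (∣m⇒∣m*n {m = x - y} (x - y) (∣ᵤ⇒∣ 2∣x-y)) (∣m⇒∣m*n {m = + 2} (x * y) (∣-refl {+ 2})))

  x²+y²>0⇒∣x∣²+∣y∣²>0 : ∀ x y → x * x + y * y > + 0 → 0 ℕ.< ∣ x ∣ ℕ.* ∣ x ∣ ℕ.+ ∣ y ∣ ℕ.* ∣ y ∣
  x²+y²>0⇒∣x∣²+∣y∣²>0 x y x²+y²>0 with subst (+ 0 <_) (x²+y²≡+[∣x∣²+∣y∣²] x y) x²+y²>0
  ... | +<+ n>0 = n>0

open import Defs
open import Data.Nat using (ℕ; _<_; _%_)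
open import Data.Nat.Primality using (Prime)
open import Data.Nat.Divisibility renaming (_∣_ to _∣ℕ_)
open import Data.Integer using (ℤ; _+_; _*_; +_; _>_; 0ℤ; ∣_∣)
open import Data.Integer.Properties using (∣i∣≡0⇒i≡0)
open import Data.Integer.Divisibility using (_∣_)
open import Data.Product using (_×_; ∃-syntax; _,_)
open import Relation.Nullary using (¬_)
open import Relation.Binary.PropositionalEquality using (_≡_; _≢_)
open Congruence using (%≡⇒mod; odd[2n+1])
open IntegerForms
open Representations

theorem2p1 : (m : ℕ) → 0 < m →
    ((Prime (2 Data.Nat.* m Data.Nat.+ 1) → (2 Data.Nat.* m Data.Nat.+ 1) % 4 ≡ 3 →
        (¬ (∃[ x ] ∃[ y ] ∃[ z ] (T (+ m) ≡ x * x + y * y + T z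
              × x * x + y * y > 0ℤ × + 2 ∣ (x Data.Integer.- y))))
      × (¬ (∃[ x ] ∃[ y ] ∃[ z ] (+ 2 * T (+ m) ≡ x * x + T y + T z
              × + 2 ∣ x × x ≢ 0ℤ))))
    × ((∀ (q : ℕ) → Prime q → q ∣ℕ (2 Data.Nat.* m Data.Nat.+ 1) → q % 4 ≡ 1) →
        (¬ (∃[ x ] ∃[ y ] ∃[ z ] (T (+ m) ≡ x * x + y * y + T z
              × ¬ (+ 2 ∣ x) × + 2 ∣ y)))
      × (¬ (∃[ x ] ∃[ y ] ∃[ z ] (+ 2 * T (+ m) ≡ x * x + T y + T z
              × ¬ (+ 2 ∣ x))))))
theorem2p1 m _ =
  (λ p-prime p≡3 →
      (λ { (x , y , z , eq , x²+y²>0 , 2∣x-y) →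
             prime≡3mod4⇒p²≢8[x²+y²]+w² {x = ∣ x ∣} {y = ∣ y ∣} p-prime (%≡⇒mod p≡3) (oddRoot-odd z)
               (+2∣x-y⇒even[∣x∣²+∣y∣²] x y 2∣x-y) (x²+y²>0⇒∣x∣²+∣y∣²>0 x y x²+y²>0) (T≡sum-of-squares+T⇒ℕ m x y z eq) })
    , (λ { (x , y , z , eq , 2∣x , x≢0) →
             prime≡3mod4⇒2p²≢8x²+a²+b² {x = ∣ x ∣} p-prime (%≡⇒mod p≡3) (oddRoot-odd y) (oddRoot-odd z)
               (+2∣⇒even x 2∣x) (λ ∣x∣≡0 → x≢0 (∣i∣≡0⇒i≡0 ∣x∣≡0)) (2T≡square+T+T⇒ℕ m x y z eq) }))
  , (λ factors≡1 →
      (λ { (x , y , z , eq , 2∤x , 2∣y) →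
             prime-factors≡1mod4⇒p²≢8[x²+y²]+w² {x = ∣ x ∣} {y = ∣ y ∣} (λ q q-prime q∣p → %≡⇒mod (factors≡1 q q-prime q∣p))
               (odd[2n+1] m) (oddRoot-odd z) (¬+2∣⇒odd x 2∤x) (+2∣⇒even y 2∣y) (T≡sum-of-squares+T⇒ℕ m x y z eq) })
    , (λ { (x , y , z , eq , 2∤x) →
             prime-factors≡1mod4⇒2p²≢8x²+a²+b² {x = ∣ x ∣} (λ q q-prime q∣p → %≡⇒mod (factors≡1 q q-prime q∣p))
               (odd[2n+1] m) (oddRoot-odd y) (oddRoot-odd z) (¬+2∣⇒odd x 2∤x) (2T≡square+T+T⇒ℕ m x y z eq) }))
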